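{- Let $j, k \in \mathbb{N}^+$ with $k > j$. Then the number of ways to split $2k+j$ balls into nonempty ordered bins (any number of bins) so that at least one bin has exactly $k$ balls is $$F_{2k+j,k,1} = \sum_{\ell=1}^{k+j} (\ell+1)\binom{k+j-1}{\ell-1} - \sum_{\ell=1}^{j} \frac{\ell^2+3\ell+2}{2}\binom{j-1}{\ell-1}.$$
   Context: $F_{2k+j,k,1}$ denotes the number of compositions of $2k+j$ (ordered tuples of positive integers, of any length, summing to $2k+j$) having at least one part equal to $k$. -}

module Defs where

open import Data.Nat using (ℕ; zero; suc; _+_; _*_; _/_; _^_; _<_)
open import Data.Nat.Combinatorics using (_C_)
open import Data.List using (List)
open import Data.Bool.ListAction using (any)
open import Data.Nat.ListAction using (sum)
open import Data.Nat using (_≡ᵇ_)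
open import Data.Bool using (true)
open import Relation.Binary.PropositionalEquality using (_≡_)
open import Data.List.Relation.Unary.All using (All)
open import Data.Product using (Σ; _×_)
open import Data.Integer using (ℤ; +_; _-_)

IsComposition : ℕ → List ℕ → Set
IsComposition n c = All (0 <_) c × sum c ≡ n

-- Compositions of n having at least one part equal to k.
-- (Boolean test so that each composition is counted exactly once,
--  independent of how many parts equal k.)
HasPart : ℕ → List ℕ → Set
HasPart k c = any (k ≡ᵇ_) c ≡ true

CompWithPart : ℕ → ℕ → Set
CompWithPart n k = Σ (List ℕ) (λ c → IsComposition n c × HasPart k c)

sum1 : ℕ → (ℕ → ℕ) → ℕ
sum1 zero    f = 0
sum1 (suc m) f = sum1 m f + f (suc m)

-- right-hand side of the formula (the division by 2 is exact: ℓ²+3ℓ+2 = (ℓ+1)(ℓ+2))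
rhs : ℕ → ℕ → ℤ
rhs j k = + sum1 (k + j) (λ ℓ → (ℓ + 1) * ((k + j ∸' 1) C (ℓ ∸' 1)))
        - + sum1 j (λ ℓ → ((ℓ ^ 2 + 3 * ℓ + 2) / 2) * ((j ∸' 1) C (ℓ ∸' 1)))
  where
  open import Data.Nat using () renaming (_∸_ to _∸'_)

-- For a composition c of n = 2k + j let occ c be the number of its parts equal to k.
-- Since 3k > n, occ c ≤ 2, hence [occ c ≥ 1] = occ c − (occ c choose 2), and summing over
-- all compositions gives N = Σ occ − Σ pairs. A composition of n with ℓ + 1 parts and one
-- marked part k is a composition of k + j with ℓ parts together with one of ℓ + 1 places
-- for the marked part; this gives the first sum. With two marked parts k one is left with a
-- composition of j with ℓ parts and (ℓ + 2 choose 2) = (ℓ² + 3ℓ + 2)/2 placements, which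
-- gives the second.
module Submission where

open import Defs
open import Data.Bool using (true; false; if_then_else_; T)
import Data.Bool.Properties as Bool
open import Data.Bool.ListAction using (any)
open import Data.Empty using (⊥; ⊥-elim)
open import Data.Fin as Fin using (Fin)
open import Data.Integer using (+_; _-_; _⊖_)
import Data.Integer.Properties as ℤ
open import Data.List using (List; []; _∷_; [_]; _++_; map; length; lookup; filter)
open import Data.List.Properties using (∷-injectiveˡ; ∷-injectiveʳ)
open import Data.List.Membership.Propositional using (_∈_)
open import Data.List.Membership.Propositional.Properties
  using (∈-++⁻; ∈-++⁺ˡ; ∈-++⁺ʳ; ∈-lookup; ∈-map⁻; ∈-map⁺; ∈-filter⁻; ∈-filter⁺)
open import Data.List.Membership.Propositional.Properties.WithK using (unique⇒irrelevant)
open import Data.List.Relation.Unary.All as All using (All; []; _∷_)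
open import Data.List.Relation.Unary.AllPairs using ([]; _∷_)
open import Data.List.Relation.Unary.Any using (here; there; index)
open import Data.List.Relation.Unary.Any.Properties using (lookup-index)
open import Data.List.Relation.Unary.Unique.Propositional using (Unique)
import Data.List.Relation.Unary.Unique.Propositional.Properties as Unique
open import Data.Nat
  using (ℕ; zero; suc; _+_; _*_; _∸_; _^_; _/_; _≤_; _<_; z≤n; s≤s; s≤s⁻¹; _≡ᵇ_; _≟_; _≤?_; >-nonZero)
open import Data.Nat.Combinatorics using (_C_; nCk+nC[k+1]≡[n+1]C[k+1])
open import Data.Nat.Combinatorics.Specification using (k>n⇒nCk≡0)
open import Data.Nat.DivMod using (m*n/n≡m)
open import Data.Nat.ListAction using (sum)
open import Data.Nat.Properties
open import Algebra.Properties.CommutativeSemigroup +-commutativeSemigroup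
  using () renaming (interchange to +-interchange)
open import Data.Nat.Tactic.RingSolver using (solve-∀)
open import Data.Product using (Σ; _×_; _,_; proj₁; proj₂)
open import Data.Sum using (inj₁; inj₂)
open import Function.Bundles using (_↔_; mk↔ₛ′)
open import Relation.Binary.PropositionalEquality hiding ([_])
import Relation.Binary.PropositionalEquality.WithK as WithK
open import Relation.Nullary using (Dec; yes; no; Irrelevant)

open ≡-Reasoning

sum1-cong : ∀ n {f g : ℕ → ℕ} → (∀ a → 1 ≤ a → a ≤ n → f a ≡ g a) → sum1 n f ≡ sum1 n g
sum1-cong zero    f≗g = refl
sum1-cong (suc n) f≗g =
  cong₂ _+_ (sum1-cong n (λ a 1≤a a≤n → f≗g a 1≤a (m≤n⇒m≤1+n a≤n))) (f≗g (suc n) (s≤s z≤n) ≤-refl)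

sum1-zeros : ∀ n {f : ℕ → ℕ} → (∀ a → 1 ≤ a → a ≤ n → f a ≡ 0) → sum1 n f ≡ 0
sum1-zeros zero    f≗0 = refl
sum1-zeros (suc n) f≗0 =
  cong₂ _+_ (sum1-zeros n (λ a 1≤a a≤n → f≗0 a 1≤a (m≤n⇒m≤1+n a≤n))) (f≗0 (suc n) (s≤s z≤n) ≤-refl)

sum1-+ : ∀ n (f g : ℕ → ℕ) → sum1 n (λ a → f a + g a) ≡ sum1 n f + sum1 n g
sum1-+ zero    f g = refl
sum1-+ (suc n) f g = begin
  sum1 n (λ a → f a + g a) + (f (suc n) + g (suc n)) ≡⟨ cong (_+ (f (suc n) + g (suc n))) (sum1-+ n f g) ⟩
  sum1 n f + sum1 n g + (f (suc n) + g (suc n))       ≡⟨ +-interchange (sum1 n f) _ _ _ ⟩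
  sum1 n f + f (suc n) + (sum1 n g + g (suc n))       ∎

sum1-* : ∀ n u (f : ℕ → ℕ) → sum1 n (λ a → u * f a) ≡ u * sum1 n f
sum1-* zero    u f = sym (*-zeroʳ u)
sum1-* (suc n) u f = trans (cong (_+ u * f (suc n)) (sum1-* n u f)) (sym (*-distribˡ-+ u (sum1 n f) (f (suc n))))

sum1-unfoldˡ : ∀ n (f : ℕ → ℕ) → sum1 (suc n) f ≡ f 1 + sum1 n (λ a → f (suc a))
sum1-unfoldˡ zero    f = sym (+-identityʳ _)
sum1-unfoldˡ (suc n) f = trans (cong (_+ f (suc (suc n))) (sum1-unfoldˡ n f)) (+-assoc (f 1) _ _)

sum1-split : ∀ x y (f : ℕ → ℕ) → sum1 (x + y) f ≡ sum1 x f + sum1 y (λ b → f (x + b))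
sum1-split x zero    f = trans (cong (λ m → sum1 m f) (+-identityʳ x)) (sym (+-identityʳ _))
sum1-split x (suc y) f = begin
  sum1 (x + suc y) f                                   ≡⟨ cong (λ m → sum1 m f) (+-suc x y) ⟩
  sum1 (x + y) f + f (suc (x + y))                     ≡⟨ cong₂ _+_ (sum1-split x y f) (cong f (sym (+-suc x y))) ⟩
  sum1 x f + sum1 y (λ b → f (x + b)) + f (x + suc y)  ≡⟨ +-assoc (sum1 x f) _ _ ⟩
  sum1 x f + sum1 (suc y) (λ b → f (x + b))            ∎

sum1-support : ∀ x d (f : ℕ → ℕ) → (∀ a → x < a → f a ≡ 0) → sum1 (x + d) f ≡ sum1 x f
sum1-support x d f f≗0 = begin
  sum1 (x + d) f                         ≡⟨ sum1-split x d f ⟩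
  sum1 x f + sum1 d (λ b → f (x + b))
    ≡⟨ cong (_+_ (sum1 x f)) (sum1-zeros d (λ b 1≤b _ → f≗0 (x + b) (x<x+b 1≤b))) ⟩
  sum1 x f + 0                           ≡⟨ +-identityʳ _ ⟩
  sum1 x f                               ∎
  where
  x<x+b : ∀ {b} → 1 ≤ b → x < x + b
  x<x+b {b} 1≤b = subst (_≤ x + b) (+-comm x 1) (+-monoʳ-≤ x 1≤b)

sum1-∸-shift : ∀ K x (G : ℕ → ℕ) → (∀ m → m < K → G m ≡ 0) →
  sum1 (K + x) (λ a → G (K + x ∸ a)) ≡ sum1 x (λ a → G (K + (x ∸ a)))
sum1-∸-shift K x G G-below = begin
  sum1 (K + x) (λ a → G (K + x ∸ a))
    ≡⟨ cong (λ m → sum1 m (λ a → G (K + x ∸ a))) (+-comm K x) ⟩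
  sum1 (x + K) (λ a → G (K + x ∸ a))
    ≡⟨ sum1-split x K _ ⟩
  sum1 x (λ a → G (K + x ∸ a)) + sum1 K (λ b → G (K + x ∸ (x + b)))
    ≡⟨ cong₂ _+_ (sum1-cong x (λ a _ a≤x → cong G (+-∸-assoc K a≤x)))
                 (sum1-zeros K (λ b 1≤b b≤K → G-below _ (below b 1≤b b≤K))) ⟩
  sum1 x (λ a → G (K + (x ∸ a))) + 0
    ≡⟨ +-identityʳ _ ⟩
  sum1 x (λ a → G (K + (x ∸ a))) ∎
  where
  below : ∀ b → 1 ≤ b → b ≤ K → K + x ∸ (x + b) < K
  below b 1≤b b≤K rewrite +-comm K x | [m+n]∸[m+o]≡n∸o x K b = ∸-monoʳ-< 1≤b b≤K

-- Tested with _≡ᵇ_, like HasPart, so that one case split on k ≡ᵇ a evaluates both.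
δ : ℕ → ℕ → ℕ
δ k a = if k ≡ᵇ a then 1 else 0

δ-refl : ∀ k → δ k k ≡ 1
δ-refl k with k ≡ᵇ k in eq
... | true  = refl
... | false = ⊥-elim (subst T eq (≡⇒≡ᵇ k k refl))

δ-≢ : ∀ {k a} → a ≢ k → δ k a ≡ 0
δ-≢ {k} {a} a≢k with k ≡ᵇ a in eq
... | true  = ⊥-elim (a≢k (sym (≡ᵇ⇒≡ k a (subst T (sym eq) _))))
... | false = refl

sum1-δ : ∀ {k} n (h : ℕ → ℕ) → 1 ≤ k → k ≤ n → sum1 n (λ a → δ k a * h a) ≡ h k
sum1-δ zero h 1≤k k≤0 with () ← ≤-trans 1≤k k≤0
sum1-δ {k} (suc n) h 1≤k k≤1+n with m≤n⇒m<n∨m≡n k≤1+n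
... | inj₁ (s≤s k≤n) =
  trans (cong₂ _+_ (sum1-δ n h 1≤k k≤n) (cong (_* h (suc n)) (δ-≢ (>⇒≢ (s≤s k≤n))))) (+-identityʳ _)
... | inj₂ refl = cong₂ _+_ (sum1-zeros n (λ a _ a≤n → cong (_* h a) (δ-≢ (<⇒≢ (s≤s a≤n)))))
                            (trans (cong (_* h k) (δ-refl k)) (+-identityʳ (h k)))

module _ {X : Set} where

  ⋃[1…_] : ℕ → (ℕ → List X) → List X
  ⋃[1… zero  ] g = []
  ⋃[1… suc n ] g = ⋃[1… n ] g ++ g (suc n)

  ∈-⋃⁻ : ∀ {x} n (g : ℕ → List X) → x ∈ ⋃[1… n ] g → Σ ℕ (λ a → 1 ≤ a × a ≤ n × x ∈ g a)
  ∈-⋃⁻ (suc n) g x∈ with ∈-++⁻ (⋃[1… n ] g) x∈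
  ... | inj₂ x∈g = suc n , s≤s z≤n , ≤-refl , x∈g
  ... | inj₁ x∈⋃ with ∈-⋃⁻ n g x∈⋃
  ...   | a , 1≤a , a≤n , x∈g = a , 1≤a , m≤n⇒m≤1+n a≤n , x∈g

  ∈-⋃⁺ : ∀ {x} n (g : ℕ → List X) a → 1 ≤ a → a ≤ n → x ∈ g a → x ∈ ⋃[1… n ] g
  ∈-⋃⁺ zero    g a 1≤a a≤0 x∈g with () ← ≤-trans 1≤a a≤0
  ∈-⋃⁺ (suc n) g a 1≤a a≤1+n x∈g with m≤n⇒m<n∨m≡n a≤1+n
  ... | inj₁ (s≤s a≤n) = ∈-++⁺ˡ (∈-⋃⁺ n g a 1≤a a≤n x∈g)
  ... | inj₂ refl      = ∈-++⁺ʳ (⋃[1… n ] g) x∈g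

  ⋃-unique : ∀ n (g : ℕ → List X) → (∀ a → Unique (g a)) →
    (∀ {x} a b → x ∈ g a → x ∈ g b → a ≡ b) → Unique (⋃[1… n ] g)
  ⋃-unique zero    g unique-g disjoint = []
  ⋃-unique (suc n) g unique-g disjoint =
    Unique.++⁺ (⋃-unique n g unique-g disjoint) (unique-g (suc n)) λ (x∈⋃ , x∈g) → fresh x∈⋃ x∈g
    where
    fresh : ∀ {x} → x ∈ ⋃[1… n ] g → x ∈ g (suc n) → ⊥
    fresh x∈⋃ x∈g with a , _ , a≤n , x∈ga ← ∈-⋃⁻ n g x∈⋃ =
      1+n≰n (subst (_≤ n) (disjoint a (suc n) x∈ga x∈g) a≤n)

  sumOver : (X → ℕ) → List X → ℕ
  sumOver f []       = 0
  sumOver f (x ∷ xs) = f x + sumOver f xs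

  sumOver-++ : ∀ (f : X → ℕ) xs ys → sumOver f (xs ++ ys) ≡ sumOver f xs + sumOver f ys
  sumOver-++ f []       ys = refl
  sumOver-++ f (x ∷ xs) ys = trans (cong (_+_ (f x)) (sumOver-++ f xs ys)) (sym (+-assoc (f x) _ _))

  sumOver-⋃ : ∀ (f : X → ℕ) n g → sumOver f (⋃[1… n ] g) ≡ sum1 n (λ a → sumOver f (g a))
  sumOver-⋃ f zero    g = refl
  sumOver-⋃ f (suc n) g = trans (sumOver-++ f (⋃[1… n ] g) (g (suc n))) (cong (_+ sumOver f (g (suc n))) (sumOver-⋃ f n g))

  sumOver-cong : ∀ {f g : X → ℕ} xs → (∀ x → f x ≡ g x) → sumOver f xs ≡ sumOver g xs
  sumOver-cong []       f≗g = refl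
  sumOver-cong (x ∷ xs) f≗g = cong₂ _+_ (f≗g x) (sumOver-cong xs f≗g)

  sumOver-linear : ∀ u (f g : X → ℕ) xs → sumOver (λ x → u * f x + g x) xs ≡ u * sumOver f xs + sumOver g xs
  sumOver-linear u f g []       = sym (trans (+-identityʳ (u * 0)) (*-zeroʳ u))
  sumOver-linear u f g (x ∷ xs) = begin
    u * f x + g x + sumOver (λ x → u * f x + g x) xs  ≡⟨ cong (_+_ (u * f x + g x)) (sumOver-linear u f g xs) ⟩
    u * f x + g x + (u * sumOver f xs + sumOver g xs) ≡⟨ rearrange u (f x) (g x) (sumOver f xs) (sumOver g xs) ⟩
    u * (f x + sumOver f xs) + (g x + sumOver g xs)   ∎
    where
    rearrange : ∀ u a b s t → u * a + b + (u * s + t) ≡ u * (a + s) + (b + t)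
    rearrange = solve-∀

sumOver-map : ∀ {X Y : Set} (f : Y → ℕ) (h : X → Y) xs → sumOver f (map h xs) ≡ sumOver (λ x → f (h x)) xs
sumOver-map f h []       = refl
sumOver-map f h (x ∷ xs) = cong (_+_ (f (h x))) (sumOver-map f h xs)

index-∈-lookup : ∀ {A : Set} (xs : List A) i → index (∈-lookup {xs = xs} i) ≡ i
index-∈-lookup (x ∷ xs) Fin.zero    = refl
index-∈-lookup (x ∷ xs) (Fin.suc i) = cong Fin.suc (index-∈-lookup xs i)

enumeration↔ : ∀ {A : Set} {P : A → Set} (xs : List A) → Unique xs → (∀ {x} → Irrelevant (P x)) →
  (∀ {x} → x ∈ xs → P x) → (∀ {x} → P x → x ∈ xs) → Σ A P ↔ Fin (length xs)
enumeration↔ {A} {P} xs unique irrelevant sound complete = mk↔ₛ′ to from to∘from from∘to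
  where
  to : Σ A P → Fin (length xs)
  to (x , p) = index (complete p)
  from : Fin (length xs) → Σ A P
  from i = lookup xs i , sound (∈-lookup i)
  to∘from : ∀ i → to (from i) ≡ i
  to∘from i = trans (cong index (unique⇒irrelevant unique _ _)) (index-∈-lookup xs i)
  from∘to : ∀ y → from (to y) ≡ y
  from∘to (x , p) = Σ-≡ (sym (lookup-index (complete p)))
    where
    Σ-≡ : ∀ {y} {q : P y} → y ≡ x → (y , q) ≡ (x , p)
    Σ-≡ refl = cong (x ,_) (irrelevant _ p)

compositionsOfLength : ℕ → ℕ → List (List ℕ)
compositionsOfLength n zero    = if n ≡ᵇ 0 then [ [] ] else []
compositionsOfLength n (suc ℓ) = ⋃[1… n ] (λ a → map (a ∷_) (compositionsOfLength (n ∸ a) ℓ))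

compositionsOfLength-sound : ∀ n ℓ {c} → c ∈ compositionsOfLength n ℓ → IsComposition n c × length c ≡ ℓ
compositionsOfLength-sound zero    zero    (here refl) = ([] , refl) , refl
compositionsOfLength-sound n       (suc ℓ) c∈
  with a , 1≤a , a≤n , c∈g ← ∈-⋃⁻ n _ c∈
  with c , c∈′ , refl ← ∈-map⁻ (a ∷_) c∈g
  with (positive , sum≡) , length≡ ← compositionsOfLength-sound (n ∸ a) ℓ c∈′ =
  (1≤a ∷ positive , trans (cong (_+_ a) sum≡) (m+[n∸m]≡n a≤n)) , cong suc length≡

compositionsOfLength-complete : ∀ c → All (0 <_) c → c ∈ compositionsOfLength (sum c) (length c)
compositionsOfLength-complete []      []               = here refl
compositionsOfLength-complete (a ∷ c) (0<a ∷ positive) =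
  ∈-⋃⁺ (a + sum c) _ a 0<a (m≤m+n a (sum c))
    (subst (λ m → a ∷ c ∈ map (a ∷_) (compositionsOfLength m (length c))) (sym (m+n∸m≡n a (sum c)))
           (∈-map⁺ (a ∷_) (compositionsOfLength-complete c positive)))

compositionsOfLength-unique : ∀ n ℓ → Unique (compositionsOfLength n ℓ)
compositionsOfLength-unique zero    zero    = [] ∷ []
compositionsOfLength-unique (suc n) zero    = []
compositionsOfLength-unique n       (suc ℓ) =
  ⋃-unique n _ (λ a → Unique.map⁺ ∷-injectiveʳ (compositionsOfLength-unique (n ∸ a) ℓ)) heads-differ
  where
  heads-differ : ∀ {c} a b → c ∈ map (a ∷_) (compositionsOfLength (n ∸ a) ℓ) →
    c ∈ map (b ∷_) (compositionsOfLength (n ∸ b) ℓ) → a ≡ b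
  heads-differ a b c∈a c∈b with _ , _ , refl ← ∈-map⁻ (a ∷_) c∈a | _ , _ , c≡ ← ∈-map⁻ (b ∷_) c∈b =
    ∷-injectiveˡ c≡

compositions : ℕ → List (List ℕ)
compositions n = ⋃[1… n ] (compositionsOfLength n)

compositions-sound : ∀ n {c} → c ∈ compositions n → IsComposition n c
compositions-sound n c∈ with ℓ , _ , _ , c∈ℓ ← ∈-⋃⁻ n _ c∈ = proj₁ (compositionsOfLength-sound n ℓ c∈ℓ)

compositions-complete : ∀ n {c} → 1 ≤ n → IsComposition n c → c ∈ compositions n
compositions-complete n {a ∷ c} 1≤n (positive , refl) =
  ∈-⋃⁺ (sum (a ∷ c)) _ (length (a ∷ c)) (s≤s z≤n) (length≤sum (a ∷ c) positive)
       (compositionsOfLength-complete (a ∷ c) positive)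
  where
  length≤sum : ∀ c → All (0 <_) c → length c ≤ sum c
  length≤sum []      []               = z≤n
  length≤sum (a ∷ c) (0<a ∷ positive) = +-mono-≤ 0<a (length≤sum c positive)

compositions-unique : ∀ n → Unique (compositions n)
compositions-unique n = ⋃-unique n _ (compositionsOfLength-unique n)
  λ ℓ ℓ′ c∈ℓ c∈ℓ′ → trans (sym (proj₂ (compositionsOfLength-sound n ℓ c∈ℓ)))
                           (proj₂ (compositionsOfLength-sound n ℓ′ c∈ℓ′))

total : (List ℕ → ℕ) → ℕ → ℕ → ℕ
total f n ℓ = sumOver f (compositionsOfLength n ℓ)

total-suc : ∀ f n ℓ → total f n (suc ℓ) ≡ sum1 n (λ a → total (λ c → f (a ∷ c)) (n ∸ a) ℓ)
total-suc f n ℓ = trans (sumOver-⋃ f n _)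
  (sum1-cong n (λ a _ _ → sumOver-map f (a ∷_) (compositionsOfLength (n ∸ a) ℓ)))

#compositions : ℕ → ℕ → ℕ
#compositions = total (λ _ → 1)

#compositions-binomial : ∀ x ℓ → #compositions (suc x) (suc ℓ) ≡ x C ℓ
#compositions-binomial zero    zero    = refl
#compositions-binomial zero    (suc ℓ) = refl
#compositions-binomial (suc x) ℓ       = begin
  #compositions (2 + x) (suc ℓ)
    ≡⟨ total-suc _ (2 + x) ℓ ⟩
  sum1 (2 + x) (λ a → #compositions (2 + x ∸ a) ℓ)
    ≡⟨ sum1-unfoldˡ (suc x) _ ⟩
  #compositions (suc x) ℓ + sum1 (suc x) (λ a → #compositions (suc x ∸ a) ℓ)
    ≡⟨ cong (_+_ (#compositions (suc x) ℓ)) (sym (total-suc _ (suc x) ℓ)) ⟩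
  #compositions (suc x) ℓ + #compositions (suc x) (suc ℓ)
    ≡⟨ cong (_+_ (#compositions (suc x) ℓ)) (#compositions-binomial x ℓ) ⟩
  #compositions (suc x) ℓ + x C ℓ
    ≡⟨ pascal ℓ ⟩
  suc x C ℓ ∎
  where
  pascal : ∀ ℓ → #compositions (suc x) ℓ + x C ℓ ≡ suc x C ℓ
  pascal zero    = refl
  pascal (suc ℓ) = trans (cong (_+ x C suc ℓ) (#compositions-binomial x ℓ)) (nCk+nC[k+1]≡[n+1]C[k+1] x ℓ)

#compositions-vanishes : ∀ x ℓ → x < ℓ → #compositions x ℓ ≡ 0
#compositions-vanishes zero    (suc ℓ) _         = refl
#compositions-vanishes (suc x) (suc ℓ) (s≤s x<ℓ) = trans (#compositions-binomial x ℓ) (k>n⇒nCk≡0 x<ℓ)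

#compositions-zero : ∀ n → 1 ≤ n → #compositions n 0 ≡ 0
#compositions-zero (suc n) _ = refl

sum1-weighted-#compositions : ∀ {n} d y (g w : ℕ → ℕ) → d + y ≤ n →
  (∀ a → 1 ≤ a → a ≤ d → g a ≡ 0) → (∀ ℓ → g (d + ℓ) ≡ w ℓ * #compositions y ℓ) →
  sum1 n g ≡ sum1 y (λ ℓ → w ℓ * ((y ∸ 1) C (ℓ ∸ 1)))
sum1-weighted-#compositions {n} d y g w d+y≤n head tail = begin
  sum1 n g
    ≡⟨ cong (λ m → sum1 m g) (trans (sym (m+[n∸m]≡n d+y≤n)) (+-assoc d y e)) ⟩
  sum1 (d + (y + e)) g
    ≡⟨ sum1-split d (y + e) g ⟩
  sum1 d g + sum1 (y + e) (λ ℓ → g (d + ℓ))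
    ≡⟨ cong₂ _+_ (sum1-zeros d head) (sum1-support y e _ beyond) ⟩
  sum1 y (λ ℓ → g (d + ℓ))
    ≡⟨ sum1-cong y (λ ℓ 1≤ℓ ℓ≤y → trans (tail ℓ) (cong (w ℓ *_) (binomial y ℓ 1≤ℓ ℓ≤y))) ⟩
  sum1 y (λ ℓ → w ℓ * ((y ∸ 1) C (ℓ ∸ 1))) ∎
  where
  e = n ∸ (d + y)
  beyond : ∀ ℓ → y < ℓ → g (d + ℓ) ≡ 0
  beyond ℓ y<ℓ = trans (tail ℓ) (trans (cong (w ℓ *_) (#compositions-vanishes y ℓ y<ℓ)) (*-zeroʳ (w ℓ)))
  binomial : ∀ y ℓ → 1 ≤ ℓ → ℓ ≤ y → #compositions y ℓ ≡ (y ∸ 1) C (ℓ ∸ 1)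
  binomial (suc x) (suc ℓ) _ _ = #compositions-binomial x ℓ

triangular : ℕ → ℕ
triangular zero    = 0
triangular (suc n) = suc n + triangular n

triangular-formula : ∀ ℓ → (ℓ ^ 2 + 3 * ℓ + 2) / 2 ≡ triangular (suc ℓ)
triangular-formula ℓ = begin
  (ℓ ^ 2 + 3 * ℓ + 2) / 2           ≡⟨ cong (_/ 2) (sym (double ℓ)) ⟩
  triangular (suc ℓ) * 2 / 2        ≡⟨ m*n/n≡m (triangular (suc ℓ)) 2 ⟩
  triangular (suc ℓ)                ∎
  where
  double : ∀ ℓ → triangular (suc ℓ) * 2 ≡ ℓ ^ 2 + 3 * ℓ + 2
  double zero    = refl
  double (suc ℓ) = begin
    (2 + ℓ + triangular (suc ℓ)) * 2          ≡⟨ *-distribʳ-+ 2 (2 + ℓ) (triangular (suc ℓ)) ⟩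
    (2 + ℓ) * 2 + triangular (suc ℓ) * 2      ≡⟨ cong (_+_ ((2 + ℓ) * 2)) (double ℓ) ⟩
    (2 + ℓ) * 2 + (ℓ ^ 2 + 3 * ℓ + 2)         ≡⟨ step ℓ ⟩
    suc ℓ ^ 2 + 3 * suc ℓ + 2                 ∎
    where
    step : ∀ m → (2 + m) * 2 + (m * (m * 1) + 3 * m + 2) ≡ (1 + m) * ((1 + m) * 1) + 3 * (1 + m) + 2
    step = solve-∀

module PartsEqualTo (k : ℕ) (1≤k : 1 ≤ k) where

  occurrences : List ℕ → ℕ
  occurrences []      = 0
  occurrences (a ∷ c) = δ k a + occurrences c

  pairs : List ℕ → ℕ
  pairs []      = 0
  pairs (a ∷ c) = δ k a * occurrences c + pairs c

  totalOcc totalPairs : ℕ → ℕ → ℕ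
  totalOcc   = total occurrences
  totalPairs = total pairs

  totalOcc-suc : ∀ n ℓ →
    totalOcc n (suc ℓ) ≡ sum1 n (λ a → δ k a * #compositions (n ∸ a) ℓ + totalOcc (n ∸ a) ℓ)
  totalOcc-suc n ℓ = trans (total-suc occurrences n ℓ) (sum1-cong n (λ a _ _ → split a))
    where
    split : ∀ a → total (λ c → δ k a + occurrences c) (n ∸ a) ℓ
                ≡ δ k a * #compositions (n ∸ a) ℓ + totalOcc (n ∸ a) ℓ
    split a = trans (sumOver-cong cs (λ c → cong (_+ occurrences c) (sym (*-identityʳ (δ k a)))))
                    (sumOver-linear (δ k a) (λ _ → 1) occurrences cs)
      where cs = compositionsOfLength (n ∸ a) ℓ

  totalPairs-suc : ∀ n ℓ →
    totalPairs n (suc ℓ) ≡ sum1 n (λ a → δ k a * totalOcc (n ∸ a) ℓ + totalPairs (n ∸ a) ℓ)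
  totalPairs-suc n ℓ = trans (total-suc pairs n ℓ) (sum1-cong n (λ a _ _ →
    sumOver-linear (δ k a) occurrences pairs (compositionsOfLength (n ∸ a) ℓ)))

  totalOcc-zero : ∀ n → totalOcc n 0 ≡ 0
  totalOcc-zero zero    = refl
  totalOcc-zero (suc n) = refl

  totalPairs-zero : ∀ n → totalPairs n 0 ≡ 0
  totalPairs-zero zero    = refl
  totalPairs-zero (suc n) = refl

  totalPairs-one : ∀ n → totalPairs n 1 ≡ 0
  totalPairs-one n = trans (totalPairs-suc n 0) (sum1-zeros n λ a _ _ →
    cong₂ _+_ (trans (cong (δ k a *_) (totalOcc-zero (n ∸ a))) (*-zeroʳ (δ k a))) (totalPairs-zero (n ∸ a)))

  totalOcc-below : ∀ ℓ n → n < k → totalOcc n ℓ ≡ 0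
  totalOcc-below zero    n n<k = totalOcc-zero n
  totalOcc-below (suc ℓ) n n<k = trans (totalOcc-suc n ℓ) (sum1-zeros n λ a _ a≤n →
    cong₂ _+_ (cong (_* #compositions (n ∸ a) ℓ) (δ-≢ (<⇒≢ (≤-<-trans a≤n n<k))))
              (totalOcc-below ℓ (n ∸ a) (≤-<-trans (m∸n≤m n a) n<k)))

  totalPairs-below : ∀ ℓ n → n < k + k → totalPairs n ℓ ≡ 0
  totalPairs-below zero    n n<2k = totalPairs-zero n
  totalPairs-below (suc ℓ) n n<2k = trans (totalPairs-suc n ℓ) (sum1-zeros n λ a _ _ →
    cong₂ _+_ (first a) (totalPairs-below ℓ (n ∸ a) (≤-<-trans (m∸n≤m n a) n<2k)))
    where
    first : ∀ a → δ k a * totalOcc (n ∸ a) ℓ ≡ 0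
    first a with a ≟ k
    ... | yes refl = trans (cong (δ k k *_) (totalOcc-below ℓ (n ∸ k) n-k<k)) (*-zeroʳ (δ k k))
      where n-k<k = m<n+o⇒m∸n<o n k {{>-nonZero 1≤k}} n<2k
    ... | no a≢k = cong (_* totalOcc (n ∸ a) ℓ) (δ-≢ a≢k)

  totalOcc-closed : ∀ ℓ x → totalOcc (k + x) (suc ℓ) ≡ suc ℓ * #compositions x ℓ
  totalOcc-closed ℓ x = begin
    totalOcc (k + x) (suc ℓ)
      ≡⟨ totalOcc-suc (k + x) ℓ ⟩
    sum1 (k + x) (λ a → δ k a * #compositions (k + x ∸ a) ℓ + totalOcc (k + x ∸ a) ℓ)
      ≡⟨ sum1-+ (k + x) _ _ ⟩
    sum1 (k + x) (λ a → δ k a * #compositions (k + x ∸ a) ℓ) + sum1 (k + x) (λ a → totalOcc (k + x ∸ a) ℓ)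
      ≡⟨ cong₂ _+_ (sum1-δ (k + x) _ 1≤k (m≤m+n k x)) (remaining ℓ) ⟩
    #compositions (k + x ∸ k) ℓ + ℓ * #compositions x ℓ
      ≡⟨ cong (λ m → #compositions m ℓ + ℓ * #compositions x ℓ) (m+n∸m≡n k x) ⟩
    suc ℓ * #compositions x ℓ ∎
    where
    remaining : ∀ ℓ → sum1 (k + x) (λ a → totalOcc (k + x ∸ a) ℓ) ≡ ℓ * #compositions x ℓ
    remaining zero    = sum1-zeros (k + x) (λ a _ _ → totalOcc-zero (k + x ∸ a))
    remaining (suc ℓ) = begin
      sum1 (k + x) (λ a → totalOcc (k + x ∸ a) (suc ℓ))
        ≡⟨ sum1-∸-shift k x (λ m → totalOcc m (suc ℓ)) (totalOcc-below (suc ℓ)) ⟩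
      sum1 x (λ a → totalOcc (k + (x ∸ a)) (suc ℓ))
        ≡⟨ sum1-cong x (λ a _ _ → totalOcc-closed ℓ (x ∸ a)) ⟩
      sum1 x (λ a → suc ℓ * #compositions (x ∸ a) ℓ)
        ≡⟨ sum1-* x (suc ℓ) _ ⟩
      suc ℓ * sum1 x (λ a → #compositions (x ∸ a) ℓ)
        ≡⟨ cong (suc ℓ *_) (sym (total-suc _ x ℓ)) ⟩
      suc ℓ * #compositions x (suc ℓ) ∎

  totalPairs-closed : ∀ ℓ x → totalPairs (k + k + x) (2 + ℓ) ≡ triangular (suc ℓ) * #compositions x ℓ
  totalPairs-closed ℓ x = begin
    totalPairs (k + k + x) (2 + ℓ)
      ≡⟨ totalPairs-suc (k + k + x) (suc ℓ) ⟩
    sum1 (k + k + x) (λ a → δ k a * totalOcc (k + k + x ∸ a) (suc ℓ) + totalPairs (k + k + x ∸ a) (suc ℓ))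
      ≡⟨ sum1-+ (k + k + x) _ _ ⟩
    sum1 (k + k + x) (λ a → δ k a * totalOcc (k + k + x ∸ a) (suc ℓ))
      + sum1 (k + k + x) (λ a → totalPairs (k + k + x ∸ a) (suc ℓ))
      ≡⟨ cong₂ _+_ (sum1-δ (k + k + x) _ 1≤k (≤-trans (m≤m+n k k) (m≤m+n (k + k) x)))
                   (sum1-∸-shift (k + k) x (λ m → totalPairs m (suc ℓ)) (totalPairs-below (suc ℓ))) ⟩
    totalOcc (k + k + x ∸ k) (suc ℓ) + sum1 x (λ a → totalPairs (k + k + (x ∸ a)) (suc ℓ))
      ≡⟨ cong₂ _+_ (trans (cong (λ m → totalOcc m (suc ℓ)) 2k+x∸k≡k+x) (totalOcc-closed ℓ x)) (remaining ℓ) ⟩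
    suc ℓ * #compositions x ℓ + triangular ℓ * #compositions x ℓ
      ≡⟨ *-distribʳ-+ (#compositions x ℓ) (suc ℓ) (triangular ℓ) ⟨
    triangular (suc ℓ) * #compositions x ℓ ∎
    where
    2k+x∸k≡k+x : k + k + x ∸ k ≡ k + x
    2k+x∸k≡k+x = trans (cong (_∸ k) (+-assoc k k x)) (m+n∸m≡n k (k + x))
    remaining : ∀ ℓ → sum1 x (λ a → totalPairs (k + k + (x ∸ a)) (suc ℓ)) ≡ triangular ℓ * #compositions x ℓ
    remaining zero    = sum1-zeros x (λ a _ _ → totalPairs-one (k + k + (x ∸ a)))
    remaining (suc ℓ) = begin
      sum1 x (λ a → totalPairs (k + k + (x ∸ a)) (2 + ℓ))
        ≡⟨ sum1-cong x (λ a _ _ → totalPairs-closed ℓ (x ∸ a)) ⟩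
      sum1 x (λ a → triangular (suc ℓ) * #compositions (x ∸ a) ℓ)
        ≡⟨ sum1-* x (triangular (suc ℓ)) _ ⟩
      triangular (suc ℓ) * sum1 x (λ a → #compositions (x ∸ a) ℓ)
        ≡⟨ cong (triangular (suc ℓ) *_) (sym (total-suc _ x ℓ)) ⟩
      triangular (suc ℓ) * #compositions x (suc ℓ) ∎

  hasPart? : (c : List ℕ) → Dec (HasPart k c)
  hasPart? c = any (k ≡ᵇ_) c Bool.≟ true

  indicator : List ℕ → ℕ
  indicator c = if any (k ≡ᵇ_) c then 1 else 0

  length-filter-hasPart : ∀ xs → length (filter hasPart? xs) ≡ sumOver indicator xs
  length-filter-hasPart []       = refl
  length-filter-hasPart (c ∷ xs) with any (k ≡ᵇ_) c
  ... | true  = cong suc (length-filter-hasPart xs)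
  ... | false = length-filter-hasPart xs

  pairs-≤1 : ∀ c → occurrences c ≤ 1 → pairs c ≡ 0
  pairs-≤1 []      _ = refl
  pairs-≤1 (a ∷ c) occ≤1 with k ≡ᵇ a
  ... | false = pairs-≤1 c occ≤1
  ... | true  = cong₂ _+_ (trans (*-identityˡ (occurrences c)) (n≤0⇒n≡0 occ≤0)) (pairs-≤1 c (≤-trans occ≤0 z≤n))
    where occ≤0 = s≤s⁻¹ occ≤1

  indicator+pairs : ∀ c → occurrences c ≤ 2 → indicator c + pairs c ≡ occurrences c
  indicator+pairs []      _ = refl
  indicator+pairs (a ∷ c) occ≤2 with k ≡ᵇ a
  ... | false = indicator+pairs c occ≤2
  ... | true  = cong suc (trans (cong₂ _+_ (+-identityʳ (occurrences c)) (pairs-≤1 c (s≤s⁻¹ occ≤2)))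
                                (+-identityʳ (occurrences c)))

  occurrences*k≤sum : ∀ c → occurrences c * k ≤ sum c
  occurrences*k≤sum []      = z≤n
  occurrences*k≤sum (a ∷ c) =
    ≤-trans (≤-reflexive (*-distribʳ-+ k (δ k a) (occurrences c))) (+-mono-≤ (δ*k≤ a) (occurrences*k≤sum c))
    where
    δ*k≤ : ∀ a → δ k a * k ≤ a
    δ*k≤ a with k ≡ᵇ a in eq
    ... | true  rewrite ≡ᵇ⇒≡ k a (subst T (sym eq) _) = ≤-reflexive (+-identityʳ a)
    ... | false = z≤n

  occurrences≤2 : ∀ {j c} → j < k → IsComposition (2 * k + j) c → occurrences c ≤ 2
  occurrences≤2 {j} {c} j<k (_ , sum≡) with occurrences c ≤? 2
  ... | yes occ≤2 = occ≤2
  ... | no  occ≰2 = ⊥-elim (<⇒≱ 2k+j<3k 3k≤2k+j)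
    where
    3k≤2k+j : 3 * k ≤ 2 * k + j
    3k≤2k+j = ≤-trans (*-monoˡ-≤ k (≰⇒> occ≰2)) (≤-trans (occurrences*k≤sum c) (≤-reflexive sum≡))
    2m+m≡3m : ∀ m → 2 * m + m ≡ 3 * m
    2m+m≡3m = solve-∀
    2k+j<3k : 2 * k + j < 3 * k
    2k+j<3k = subst (2 * k + j <_) (2m+m≡3m k) (+-monoʳ-< (2 * k) j<k)

  inclusion–exclusion : ∀ xs → (∀ {c} → c ∈ xs → occurrences c ≤ 2) →
    length (filter hasPart? xs) + sumOver pairs xs ≡ sumOver occurrences xs
  inclusion–exclusion xs occ≤2 = trans (cong (_+ sumOver pairs xs) (length-filter-hasPart xs)) (pointwise xs occ≤2)
    where
    pointwise : ∀ xs → (∀ {c} → c ∈ xs → occurrences c ≤ 2) →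
      sumOver indicator xs + sumOver pairs xs ≡ sumOver occurrences xs
    pointwise []       _     = refl
    pointwise (c ∷ xs) occ≤2 = trans (+-interchange (indicator c) (sumOver indicator xs) (pairs c) (sumOver pairs xs))
      (cong₂ _+_ (indicator+pairs c (occ≤2 (here refl))) (pointwise xs (λ c∈ → occ≤2 (there c∈))))

  withPart↔ : ∀ n → 1 ≤ n → CompWithPart n k ↔ Fin (length (filter hasPart? (compositions n)))
  withPart↔ n 1≤n = enumeration↔ (filter hasPart? (compositions n))
    (Unique.filter⁺ hasPart? (compositions-unique n)) irrelevant
    (λ c∈ → let c∈′ , has = ∈-filter⁻ hasPart? c∈ in compositions-sound n c∈′ , has)
    (λ (isComposition , has) → ∈-filter⁺ hasPart? (compositions-complete n 1≤n isComposition) has)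
    where
    irrelevant : ∀ {c} → Irrelevant (IsComposition n c × HasPart k c)
    irrelevant ((pos , sum≡) , has) ((pos′ , sum≡′) , has′) =
      cong₂ _,_ (cong₂ _,_ (All.irrelevant ≤-irrelevant pos pos′) (WithK.≡-irrelevant sum≡ sum≡′))
                (WithK.≡-irrelevant has has′)

  2k+j≡k+k+j : ∀ j → 2 * k + j ≡ k + k + j
  2k+j≡k+k+j j = cong (λ m → k + m + j) (+-identityʳ k)

  Σ-totalOcc : ∀ j →
    sum1 (2 * k + j) (totalOcc (2 * k + j)) ≡ sum1 (k + j) (λ ℓ → (ℓ + 1) * ((k + j ∸ 1) C (ℓ ∸ 1)))
  Σ-totalOcc j = sum1-weighted-#compositions 1 (k + j) (totalOcc n) (_+ 1)
    (≤-trans (+-monoˡ-≤ (k + j) 1≤k) (≤-reflexive (sym n≡k+[k+j])))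
    (λ { 1 _ _ → trans (tail 0) (cong (1 *_) (#compositions-zero (k + j) (≤-trans 1≤k (m≤m+n k j))))
       ; (suc (suc _)) _ (s≤s ()) })
    tail
    where
    n = 2 * k + j
    n≡k+[k+j] : n ≡ k + (k + j)
    n≡k+[k+j] = trans (2k+j≡k+k+j j) (+-assoc k k j)
    tail : ∀ ℓ → totalOcc n (1 + ℓ) ≡ (ℓ + 1) * #compositions (k + j) ℓ
    tail ℓ = trans (cong (λ m → totalOcc m (suc ℓ)) n≡k+[k+j])
                   (trans (totalOcc-closed ℓ (k + j)) (cong (_* #compositions (k + j) ℓ) (+-comm 1 ℓ)))

  Σ-totalPairs : ∀ j → 1 ≤ j →
    sum1 (2 * k + j) (totalPairs (2 * k + j)) ≡ sum1 j (λ ℓ → ((ℓ ^ 2 + 3 * ℓ + 2) / 2) * ((j ∸ 1) C (ℓ ∸ 1)))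
  Σ-totalPairs j 1≤j = sum1-weighted-#compositions 2 j (totalPairs n) (λ ℓ → (ℓ ^ 2 + 3 * ℓ + 2) / 2)
    (+-monoˡ-≤ j (*-monoʳ-≤ 2 1≤k))
    (λ { 1 _ _ → totalPairs-one n
       ; 2 _ _ → trans (tail 0) (cong (1 *_) (#compositions-zero j 1≤j))
       ; (suc (suc (suc _))) _ (s≤s (s≤s ())) })
    tail
    where
    n = 2 * k + j
    tail : ∀ ℓ → totalPairs n (2 + ℓ) ≡ ((ℓ ^ 2 + 3 * ℓ + 2) / 2) * #compositions j ℓ
    tail ℓ = trans (cong (λ m → totalPairs m (2 + ℓ)) (2k+j≡k+k+j j))
                   (trans (totalPairs-closed ℓ j) (cong (_* #compositions j ℓ) (sym (triangular-formula ℓ))))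

m+n≡o⇒+m≡+o-+n : ∀ {m n o} → m + n ≡ o → + m ≡ + o - + n
m+n≡o⇒+m≡+o-+n {m} {n} refl = sym (begin
  + (m + n) - + n    ≡⟨ ℤ.[+m]-[+n]≡m⊖n (m + n) n ⟩
  (m + n) ⊖ n        ≡⟨ ℤ.⊖-≥ (m≤n+m n m) ⟩
  + (m + n ∸ n)      ≡⟨ cong +_ (m+n∸n≡m m n) ⟩
  + m                ∎)

mainTheorem9 : (j k : ℕ) → 0 < j → 0 < k → j < k →
    Σ ℕ (λ N → (CompWithPart (2 * k + j) k ↔ Fin N) × (+ N ≡ rhs j k))
mainTheorem9 j k 0<j 0<k j<k = length withPart , withPart↔ n 1≤n , m+n≡o⇒+m≡+o-+n counting
  where
  open PartsEqualTo k 0<k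
  n = 2 * k + j
  1≤n = ≤-trans 0<j (m≤n+m j (2 * k))
  withPart = filter hasPart? (compositions n)
  counting : length withPart + sum1 j (λ ℓ → ((ℓ ^ 2 + 3 * ℓ + 2) / 2) * ((j ∸ 1) C (ℓ ∸ 1)))
           ≡ sum1 (k + j) (λ ℓ → (ℓ + 1) * ((k + j ∸ 1) C (ℓ ∸ 1)))
  counting = begin
    length withPart + _
      ≡⟨ cong (_+_ (length withPart)) (sym (Σ-totalPairs j 0<j)) ⟩
    length withPart + sum1 n (totalPairs n)
      ≡⟨ cong (_+_ (length withPart)) (sym (sumOver-⋃ pairs n _)) ⟩
    length withPart + sumOver pairs (compositions n)
      ≡⟨ inclusion–exclusion (compositions n) (λ c∈ → occurrences≤2 j<k (compositions-sound n c∈)) ⟩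
    sumOver occurrences (compositions n)
      ≡⟨ sumOver-⋃ occurrences n _ ⟩
    sum1 n (totalOcc n)
      ≡⟨ Σ-totalOcc j ⟩
    _ ∎
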